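{- Let $m \geq 1$ be an integer and let $G$ be a connected graph with at least three vertices. Then $$\omega(G)+1 \leq \chi_\rho(FSSD_m(G)) \leq \chi_\rho(G)+1,$$ where $\omega(G)$ is the clique number of $G$.
   Context: All graphs are finite and simple. For a positive integer $i$, an $i$-packing in a graph $G$ is a set of vertices in which any two distinct vertices are at distance greater than $i$. The packing chromatic number $\chi_\rho(G)$ is the smallest integer $k$ such that $V(G)$ can be partitioned into sets $V_1,\dots,V_k$ with each $V_i$ an $i$-packing; equivalently, the smallest $k$ for which there is a map $c:V(G)\to\{1,\dots,k\}$ such that $c(u)=c(v)=i$ for distinct $u,v$ implies $d_G(u,v)>i$ (a $k$-packing coloring). For a positive integer $m$, the finite super subdivision graph $FSSD_m(G)$ is obtained from $G$ by replacing each edge $uv$ of $G$ by a complete bipartite graph $K_{2,m}$ whose part of size $2$ is $\{u,v\}$; that is, the edge $uv$ is deleted and $m$ new vertices (called subdivided vertices) are added, each adjacent exactly to $u$ and $v$. -}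

module Defs where

open import Data.Nat using (ℕ; zero; suc; _≤_)
open import Data.Fin using (Fin; toℕ) renaming (_<_ to _<ᶠ_)
open import Data.Fin.Subset using (Subset; _∈_; ∣_∣)
open import Data.Bool using (Bool; true; false; T)
open import Data.Product using (Σ; _×_; _,_; ∃)
open import Data.Sum using (_⊎_; inj₁; inj₂)
open import Data.Empty using (⊥)
open import Relation.Nullary using (¬_)
open import Relation.Binary.PropositionalEquality using (_≡_; _≢_)

record Graph : Set₁ where
  field
    V      : Set
    Adj    : V → V → Set
    sym    : ∀ {u v} → Adj u v → Adj v u
    irrefl : ∀ {u} → ¬ Adj u u
open Graph public

record SimpleGraph (n : ℕ) : Set where
  field
    adj        : Fin n → Fin n → Bool
    adj-sym    : ∀ u v → adj u v ≡ adj v u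
    adj-irrefl : ∀ u → adj u u ≡ false
open SimpleGraph public

irr-helper : ∀ {b : Bool} → b ≡ false → ¬ T b
irr-helper {true} () _
irr-helper {false} _ ()

sym-helper : ∀ {a b : Bool} → a ≡ b → T a → T b
sym-helper Relation.Binary.PropositionalEquality.refl t = t

toGraph : ∀ {n} → SimpleGraph n → Graph
toGraph {n} G = record
  { V = Fin n
  ; Adj = λ u v → T (adj G u v)
  ; sym = λ {u} {v} → sym-helper (adj-sym G u v)
  ; irrefl = λ {u} → irr-helper (adj-irrefl G u)
  }

data Walk (G : Graph) : V G → V G → ℕ → Set where
  here : ∀ {u} → Walk G u u zero
  step : ∀ {u w v k} → Adj G u w → Walk G w v k → Walk G u v (suc k)

-- d_G(u,v) ≤ i  (distance is the minimum length of a walk).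
DistLe : (G : Graph) → V G → V G → ℕ → Set
DistLe G u v i = Σ ℕ λ k → k ≤ i × Walk G u v k

Connected : Graph → Set
Connected G = ∀ u v → ∃ λ k → Walk G u v k

-- A k-packing coloring: colour c u ∈ Fin k stands for the colour suc (toℕ (c u)) ∈ {1..k};
-- distinct vertices of the same colour i must be at distance > i.
IsPackingColoring : (G : Graph) (k : ℕ) → (V G → Fin k) → Set
IsPackingColoring G k c =
  ∀ u v → u ≢ v → c u ≡ c v → ¬ DistLe G u v (suc (toℕ (c u)))

HasPackingColoring : Graph → ℕ → Set
HasPackingColoring G k = Σ (V G → Fin k) (IsPackingColoring G k)

IsPackingChromaticNumber : Graph → ℕ → Set
IsPackingChromaticNumber G k =
  HasPackingColoring G k × (∀ j → HasPackingColoring G j → k ≤ j)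

IsClique : ∀ {n} → SimpleGraph n → Subset n → Set
IsClique G S = ∀ u v → u ∈ S → v ∈ S → u ≢ v → T (adj G u v)

IsCliqueNumber : ∀ {n} → SimpleGraph n → ℕ → Set
IsCliqueNumber {n} G w =
  (Σ (Subset n) λ S → IsClique G S × ∣ S ∣ ≡ w)
  × (∀ S → IsClique G S → ∣ S ∣ ≤ w)

-- Subdivided vertices: for each edge {u,v} (listed once, with u < v) m new vertices.
SubVertex : ∀ {n} → SimpleGraph n → ℕ → Set
SubVertex {n} G m = Σ (Fin n) λ u → Σ (Fin n) λ v → (u <ᶠ v) × T (adj G u v) × Fin m

EndOf : ∀ {n} {G : SimpleGraph n} {m} → Fin n → SubVertex G m → Set
EndOf x (u , v , _) = x ≡ u ⊎ x ≡ v

FSSDAdj : ∀ {n} (G : SimpleGraph n) m → Fin n ⊎ SubVertex G m → Fin n ⊎ SubVertex G m → Set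
FSSDAdj G m (inj₁ x) (inj₁ y) = ⊥
FSSDAdj G m (inj₁ x) (inj₂ s) = EndOf {G = G} x s
FSSDAdj G m (inj₂ s) (inj₁ x) = EndOf {G = G} x s
FSSDAdj G m (inj₂ s) (inj₂ t) = ⊥

FSSDsym : ∀ {n} (G : SimpleGraph n) m {a b} → FSSDAdj G m a b → FSSDAdj G m b a
FSSDsym G m {inj₁ x} {inj₂ s} p = p
FSSDsym G m {inj₂ s} {inj₁ x} p = p

FSSDirr : ∀ {n} (G : SimpleGraph n) m {a} → ¬ FSSDAdj G m a a
FSSDirr G m {inj₁ x} ()
FSSDirr G m {inj₂ s} ()

-- The finite super subdivision graph FSSD_m(G): each edge uv replaced by K_{2,m}.
FSSD : ∀ {n} → ℕ → SimpleGraph n → Graph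
FSSD m G = record
  { V = Fin _ ⊎ SubVertex G m
  ; Adj = FSSDAdj G m
  ; sym = λ {a} {b} → FSSDsym G m {a} {b}
  ; irrefl = λ {a} → FSSDirr G m {a}
  }

module Submission where

-- A walk of length L in FSSD_m(G) between two original vertices
-- contracts to a walk of length at most L/2 in G.  Hence colouring every
-- subdivided vertex 1 (they form an independent set) and every original vertex
-- by its colour in G plus one is a packing colouring of FSSD_m(G).
--
-- We fix one subdivided vertex `mid a b` on every edge a – b.
-- (i)  A connected graph on ≥ 3 vertices contains a path a – b – d; then
--      a – (ab) – b – (bd) is a path on four vertices of FSSD_m(G), which
--      admits no packing colouring with two colours.  This gives χ_ρ ≥ 3,
--      which settles ω ≤ 2.
-- (ii) For a clique of size W ≥ 3 we exhibit W + 1 distinct colours (module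
--      Clique): either no clique vertex has colour 1, so the clique vertices
--      (pairwise at distance 2) carry W distinct colours other than 1, or a
--      clique vertex x of colour 1 together with its W − 1 "spokes"
--      (the subdivided vertices of the edges at x) carries W distinct colours,
--      and a case analysis on the colours of the remaining clique vertices
--      produces one more vertex whose colour is new.

open import Defs
open import Data.Nat using (ℕ; zero; suc; _≤_; _+_; z≤n; s≤s; _≤?_; _≟_)
open import Data.Nat.Properties
  using (≤-trans; ≤-reflexive; ≤-antisym; ≤-pred; ≰⇒>; n≢0⇒n>0; m≤n⇒m<n∨m≡n;
         m≤n⇒m≤1+n; m≤n+m; n<1⇒n≡0; +-suc; +-comm; +-monoˡ-≤)
open import Data.Fin using (Fin; zero; suc; toℕ; punchIn)
import Data.Fin.Properties as FinP
open import Data.Fin.Subset using (Subset; _∈_; ∣_∣; inside; outside)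
open import Data.Vec using ([]; _∷_; here; there)
open import Data.Vec.Functional using () renaming (_∷_ to _◂_)
open import Data.Product using (Σ; _×_; _,_; proj₂)
open import Data.Sum using (_⊎_; inj₁; inj₂; [_,_]′)
open import Data.Sum.Properties using (inj₁-injective)
open import Data.Empty using (⊥-elim)
open import Function using (_∘_)
open import Relation.Nullary using (¬_; Dec; yes; no)
open import Relation.Binary using (DecidableEquality; tri<; tri≈; tri>)
open import Relation.Binary.PropositionalEquality
  using (_≡_; _≢_; refl; trans; cong; subst) renaming (sym to ≡-sym)

Distinct : ∀ {A : Set} {a} → (Fin a → A) → Set
Distinct f = ∀ i j → i ≢ j → f i ≢ f j

distinct⇒≤ : ∀ {a b} (f : Fin a → Fin b) → Distinct f → a ≤ b
distinct⇒≤ f f-distinct = FinP.injective⇒≤ injective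
  where
  injective : ∀ {i j} → f i ≡ f j → i ≡ j
  injective {i} {j} fi≡fj with i FinP.≟ j
  ... | yes i≡j = i≡j
  ... | no i≢j = ⊥-elim (f-distinct i j i≢j fi≡fj)

distinct-◂ : ∀ {A : Set} {a} {f : Fin a → A} {t : A} →
             Distinct f → (∀ i → t ≢ f i) → Distinct (t ◂ f)
distinct-◂ f-distinct fresh zero    zero    0≢0 = ⊥-elim (0≢0 refl)
distinct-◂ f-distinct fresh zero    (suc j) _   = fresh j
distinct-◂ f-distinct fresh (suc i) zero    _   = fresh i ∘ ≡-sym
distinct-◂ f-distinct fresh (suc i) (suc j) i≢j = f-distinct i j (i≢j ∘ cong suc)

-- A nonempty distinct family in Fin b avoiding 0 leaves 0 as one more value.
distinct-nonzero⇒< : ∀ {a b} (f : Fin (suc a) → Fin b) → Distinct f →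
                     (∀ i → toℕ (f i) ≢ 0) → suc (suc a) ≤ b
distinct-nonzero⇒< {b = zero}  f _          _       = ⊥-elim (FinP.¬Fin0 (f zero))
distinct-nonzero⇒< {b = suc b} f f-distinct nonzero =
  distinct⇒≤ (zero ◂ f) (distinct-◂ f-distinct λ i 0≡fi → nonzero i (cong toℕ (≡-sym 0≡fi)))

InPair : ℕ → ℕ → Set
InPair l r = r ≡ l ⊎ r ≡ suc l

in-pair : ∀ {l r} → l ≤ r → r ≤ suc l → InPair l r
in-pair l≤r r≤1+l with m≤n⇒m<n∨m≡n r≤1+l
... | inj₁ r<1+l = inj₁ (≤-antisym (≤-pred r<1+l) l≤r)
... | inj₂ r≡1+l = inj₂ r≡1+l

two-values : ∀ {l r s t} → InPair l r → InPair l s → InPair l t → r ≢ s → s ≢ t → r ≡ t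
two-values (inj₁ refl) (inj₁ refl) _           r≢s _   = ⊥-elim (r≢s refl)
two-values (inj₂ refl) (inj₂ refl) _           r≢s _   = ⊥-elim (r≢s refl)
two-values _           (inj₁ refl) (inj₁ refl) _   s≢t = ⊥-elim (s≢t refl)
two-values _           (inj₂ refl) (inj₂ refl) _   s≢t = ⊥-elim (s≢t refl)
two-values (inj₁ refl) (inj₂ refl) (inj₁ refl) _   _   = refl
two-values (inj₂ refl) (inj₁ refl) (inj₂ refl) _   _   = refl

enumerate : ∀ {n} (S : Subset n) → Σ (Fin ∣ S ∣ → Fin n) λ e → Distinct e × (∀ i → e i ∈ S)
enumerate [] = (λ ()) , (λ ()) , (λ ())
enumerate (inside ∷ S) with enumerate S
... | e , e-distinct , e∈S =
  (zero ◂ (suc ∘ e)) ,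
  distinct-◂ (λ i j i≢j → e-distinct i j i≢j ∘ FinP.suc-injective) (λ i ()) ,
  λ { zero → here ; (suc i) → there (e∈S i) }
enumerate (outside ∷ S) with enumerate S
... | e , e-distinct , e∈S =
  suc ∘ e , (λ i j i≢j → e-distinct i j i≢j ∘ FinP.suc-injective) , there ∘ e∈S

infixr 5 _++ʷ_
_++ʷ_ : ∀ {G : Graph} {u v x k l} → Walk G u v k → Walk G v x l → Walk G u x (k + l)
here         ++ʷ walk = walk
step uw rest ++ʷ walk = step uw (rest ++ʷ walk)

TwoPath : Graph → Set
TwoPath G = Σ (V G) λ a → Σ (V G) λ b → Σ (V G) λ d → Adj G a b × Adj G b d × a ≢ d

-- Walking from the edge x – y towards a third vertex d, the first step leaving
-- {x, y} completes a two-path.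
two-path-towards : ∀ {G : Graph} → DecidableEquality (V G) →
                   ∀ {x y d k} → Adj G x y → d ≢ x → d ≢ y → Walk G x d k → TwoPath G
two-path-towards _≟ᵥ_ xy d≢x d≢y here = ⊥-elim (d≢x refl)
two-path-towards {G} _≟ᵥ_ {x} {y} xy d≢x d≢y (step {w = x₁} xx₁ rest) with x₁ ≟ᵥ y
... | yes refl = two-path-towards _≟ᵥ_ (sym G xy) d≢y d≢x rest
... | no x₁≢y  = y , x , x₁ , sym G xy , xx₁ , x₁≢y ∘ ≡-sym

connected⇒two-path : ∀ {G : Graph} → DecidableEquality (V G) → Connected G →
                     (v₀ v₁ v₂ : V G) → v₀ ≢ v₁ → v₀ ≢ v₂ → v₁ ≢ v₂ → TwoPath G
connected⇒two-path _≟ᵥ_ conn v₀ v₁ v₂ v₀≢v₁ v₀≢v₂ v₁≢v₂ with conn v₀ v₁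
... | _ , here = ⊥-elim (v₀≢v₁ refl)
... | _ , step {w = u} v₀u _ with v₁ ≟ᵥ u
...   | yes refl = two-path-towards _≟ᵥ_ v₀u (v₀≢v₂ ∘ ≡-sym) (v₁≢v₂ ∘ ≡-sym) (proj₂ (conn v₀ v₂))
...   | no v₁≢u = two-path-towards _≟ᵥ_ v₀u (v₀≢v₁ ∘ ≡-sym) v₁≢u (proj₂ (conn v₀ v₁))

module PackingColouring (G : Graph) {K : ℕ} (c : V G → Fin K) (c-ok : IsPackingColoring G K c) where

  -- The colour of u, minus one.
  rank : V G → ℕ
  rank u = toℕ (c u)

  separated : ∀ {u v L} → u ≢ v → Walk G u v L → L ≤ suc (rank u) → c u ≢ c v
  separated u≢v walk L≤ cu≡cv = c-ok _ _ u≢v cu≡cv (_ , L≤ , walk)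

  adjacent-colours-differ : ∀ {u v} → Adj G u v → c u ≢ c v
  adjacent-colours-differ uv = separated (λ { refl → irrefl G uv }) (step uv here) (s≤s z≤n)

  colour-1≢higher : ∀ {u v} → rank u ≡ 0 → 1 ≤ rank v → c u ≢ c v
  colour-1≢higher u-colour-1 v-higher cu≡cv
    with subst (1 ≤_) (trans (cong toℕ (≡-sym cu≡cv)) u-colour-1) v-higher
  ... | ()

  beside-colour-1 : ∀ {u v} → Adj G u v → rank u ≡ 0 → 1 ≤ rank v
  beside-colour-1 uv u-colour-1 =
    n≢0⇒n>0 λ v-colour-1 → adjacent-colours-differ uv (FinP.toℕ-injective (trans u-colour-1 (≡-sym v-colour-1)))

  same-colour-at-distance-2 : ∀ {u v} → u ≢ v → Walk G u v 2 → c u ≡ c v → rank u ≡ 0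
  same-colour-at-distance-2 {u} u≢v walk cu≡cv with 1 ≤? rank u
  ... | yes u-higher = ⊥-elim (separated u≢v walk (s≤s u-higher) cu≡cv)
  ... | no u-lowest  = n<1⇒n≡0 (≰⇒> u-lowest)

  -- A path v₀ – v₁ – v₂ – v₃ (v₀ ≠ v₂, v₁ ≠ v₃) has no packing colouring with two
  -- colours: the colours alternate, so v₀, v₂ and v₁, v₃ repeat a colour at distance
  -- two, which must be colour 1 both times, contradicting v₀ – v₁.
  path₄-needs-three-colours : ∀ {v₀ v₁ v₂ v₃} → Adj G v₀ v₁ → Adj G v₁ v₂ → Adj G v₂ v₃ →
                              v₀ ≢ v₂ → v₁ ≢ v₃ → ¬ K ≤ 2
  path₄-needs-three-colours {v₀} {v₁} {v₂} {v₃} a₀₁ a₁₂ a₂₃ v₀≢v₂ v₁≢v₃ K≤2 =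
    adjacent-colours-differ a₀₁ (FinP.toℕ-injective (trans v₀-colour-1 (≡-sym v₁-colour-1)))
    where
    binary : ∀ v → InPair 0 (rank v)
    binary v = in-pair z≤n (≤-pred (≤-trans (FinP.toℕ<n (c v)) K≤2))
    ranks-differ : ∀ {u v} → Adj G u v → rank u ≢ rank v
    ranks-differ uv = adjacent-colours-differ uv ∘ FinP.toℕ-injective
    v₀-colour-1 : rank v₀ ≡ 0
    v₀-colour-1 = same-colour-at-distance-2 v₀≢v₂ (step a₀₁ (step a₁₂ here)) (FinP.toℕ-injective
      (two-values (binary v₀) (binary v₁) (binary v₂) (ranks-differ a₀₁) (ranks-differ a₁₂)))
    v₁-colour-1 : rank v₁ ≡ 0
    v₁-colour-1 = same-colour-at-distance-2 v₁≢v₃ (step a₁₂ (step a₂₃ here)) (FinP.toℕ-injective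
      (two-values (binary v₁) (binary v₂) (binary v₃) (ranks-differ a₁₂) (ranks-differ a₂₃)))

half-≤ : ∀ L t → L + L ≤ suc t → L ≤ t
half-≤ zero    t _         = z≤n
half-≤ (suc L) t (s≤s 2L≤) = ≤-trans (m≤n+m (suc L) L) 2L≤

module Subdivision {n} (G : SimpleGraph n) (m : ℕ) where

  Gᵒ : Graph
  Gᵒ = toGraph G

  F : Graph
  F = FSSD m G

  end-distinguishes : ∀ {x s t} → EndOf {G = G} x t → ¬ EndOf {G = G} x s →
                      _≢_ {A = V F} (inj₂ s) (inj₂ t)
  end-distinguishes x∈t x∉s refl = x∉s x∈t

  ends-adjacent : ∀ {x z} (s : SubVertex G m) → EndOf {G = G} x s → EndOf {G = G} z s →
                  x ≡ z ⊎ Adj Gᵒ x z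
  ends-adjacent (u , v , _ , uv , _) (inj₁ refl) (inj₁ refl) = inj₁ refl
  ends-adjacent (u , v , _ , uv , _) (inj₁ refl) (inj₂ refl) = inj₂ uv
  ends-adjacent (u , v , _ , uv , _) (inj₂ refl) (inj₁ refl) = inj₂ (sym Gᵒ uv)
  ends-adjacent (u , v , _ , uv , _) (inj₂ refl) (inj₂ refl) = inj₁ refl

  -- A walk of length L between original vertices of FSSD_m(G) contracts to a walk
  -- of length L' in G with 2L' ≤ L: every second vertex is subdivided.
  contract : ∀ {x y L} → Walk F (inj₁ x) (inj₁ y) L → Σ ℕ λ L' → L' + L' ≤ L × Walk Gᵒ x y L'
  contract here = 0 , z≤n , here
  contract (step {w = inj₂ s} xs (step {w = inj₁ z} sz rest))
    with contract rest | ends-adjacent s xs sz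
  ... | L' , 2L'≤ , walk | inj₁ refl = L' , m≤n⇒m≤1+n (m≤n⇒m≤1+n 2L'≤) , walk
  ... | L' , 2L'≤ , walk | inj₂ xz   =
    suc L' , s≤s (≤-trans (≤-reflexive (+-suc L' L')) (s≤s 2L'≤)) , step xz walk

  lift-colouring : ∀ {k} → HasPackingColoring Gᵒ k → HasPackingColoring F (suc k)
  lift-colouring {k} (cG , cG-ok) = cF , cF-ok
    where
    cF : V F → Fin (suc k)
    cF (inj₁ x) = suc (cG x)
    cF (inj₂ s) = zero
    cF-ok : IsPackingColoring F (suc k) cF
    cF-ok (inj₁ x) (inj₁ y) x≢y same (L , L≤ , walk) with contract walk
    ... | L' , 2L'≤ , walkᵒ =
      cG-ok x y (x≢y ∘ cong inj₁) (FinP.suc-injective same)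
            (L' , half-≤ L' _ (≤-trans 2L'≤ L≤) , walkᵒ)
    cF-ok (inj₂ s) (inj₂ t) s≢t _ (0 , _ , here) = s≢t refl
    cF-ok (inj₂ s) (inj₂ t) s≢t _ (1 , _ , step {w = inj₁ x} _ ())
    cF-ok (inj₂ s) (inj₂ t) s≢t _ (suc (suc _) , s≤s () , _)

  module Representatives (i₀ : Fin m) where

    mid : ∀ a b → Adj Gᵒ a b → SubVertex G m
    mid a b ab with FinP.<-cmp a b
    ... | tri< a<b _ _ = a , b , a<b , ab , i₀
    ... | tri≈ _ refl _ = ⊥-elim (irrefl Gᵒ ab)
    ... | tri> _ _ b<a = b , a , b<a , sym Gᵒ ab , i₀

    mid-endˡ : ∀ a b ab → EndOf {G = G} a (mid a b ab)
    mid-endˡ a b ab with FinP.<-cmp a b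
    ... | tri< _ _ _    = inj₁ refl
    ... | tri≈ _ refl _ = ⊥-elim (irrefl Gᵒ ab)
    ... | tri> _ _ _    = inj₂ refl

    mid-endʳ : ∀ a b ab → EndOf {G = G} b (mid a b ab)
    mid-endʳ a b ab with FinP.<-cmp a b
    ... | tri< _ _ _    = inj₂ refl
    ... | tri≈ _ refl _ = ⊥-elim (irrefl Gᵒ ab)
    ... | tri> _ _ _    = inj₁ refl

    mid-not-end : ∀ {x} a b ab → x ≢ a → x ≢ b → ¬ EndOf {G = G} x (mid a b ab)
    mid-not-end a b ab x≢a x≢b x-end with FinP.<-cmp a b
    mid-not-end a b ab x≢a x≢b (inj₁ x≡a) | tri< _ _ _ = x≢a x≡a
    mid-not-end a b ab x≢a x≢b (inj₂ x≡b) | tri< _ _ _ = x≢b x≡b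
    mid-not-end a b ab x≢a x≢b _          | tri≈ _ refl _ = irrefl Gᵒ ab
    mid-not-end a b ab x≢a x≢b (inj₁ x≡b) | tri> _ _ _ = x≢b x≡b
    mid-not-end a b ab x≢a x≢b (inj₂ x≡a) | tri> _ _ _ = x≢a x≡a

    two-path⇒three-colours : TwoPath Gᵒ → ∀ {K} → HasPackingColoring F K → 3 ≤ K
    two-path⇒three-colours (a , b , d , ab , bd , a≢d) (c , c-ok) =
      ≰⇒> (path₄-needs-three-colours
             {inj₁ a} {inj₂ (mid a b ab)} {inj₁ b} {inj₂ (mid b d bd)}
             (mid-endˡ a b ab) (mid-endʳ a b ab) (mid-endˡ b d bd)
             (a≢b ∘ inj₁-injective)
             (end-distinguishes (mid-endˡ a b ab) (mid-not-end b d bd a≢b a≢d) ∘ ≡-sym))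
      where
      open PackingColouring F c c-ok
      a≢b : a ≢ b
      a≢b refl = irrefl Gᵒ ab

module Clique {n} (G : SimpleGraph n) {m} (i₀ : Fin m)
              {K} (c : V (FSSD m G) → Fin K) (c-ok : IsPackingColoring (FSSD m G) K c)
              (w₁ : ℕ) (e : Fin (suc w₁) → Fin n) (e-distinct : Distinct e)
              (e-clique : ∀ i j → i ≢ j → Adj (toGraph G) (e i) (e j)) where

  open Subdivision G m
  open Representatives i₀
  open PackingColouring F c c-ok

  W : ℕ
  W = suc w₁

  cv : Fin W → V F
  cv j = inj₁ (e j)

  sub : ∀ i j → i ≢ j → V F
  sub i j i≢j = inj₂ (mid (e i) (e j) (e-clique i j i≢j))

  enterˡ : ∀ i j i≢j → Walk F (cv i) (sub i j i≢j) 1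
  enterˡ i j i≢j = step (mid-endˡ (e i) (e j) (e-clique i j i≢j)) here

  enterʳ : ∀ i j i≢j → Walk F (cv j) (sub i j i≢j) 1
  enterʳ i j i≢j = step (mid-endʳ (e i) (e j) (e-clique i j i≢j)) here

  leaveˡ : ∀ i j i≢j → Walk F (sub i j i≢j) (cv i) 1
  leaveˡ i j i≢j = step (mid-endˡ (e i) (e j) (e-clique i j i≢j)) here

  leaveʳ : ∀ i j i≢j → Walk F (sub i j i≢j) (cv j) 1
  leaveʳ i j i≢j = step (mid-endʳ (e i) (e j) (e-clique i j i≢j)) here

  cv≢ : ∀ {i j} → i ≢ j → cv i ≢ cv j
  cv≢ {i} {j} i≢j = e-distinct i j i≢j ∘ inj₁-injective

  edge≢ : ∀ i j i≢j {x t} → EndOf {G = G} (e x) t → x ≢ i → x ≢ j → sub i j i≢j ≢ inj₂ t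
  edge≢ i j i≢j x∈t x≢i x≢j =
    end-distinguishes x∈t (mid-not-end (e i) (e j) _ (e-distinct _ i x≢i) (e-distinct _ j x≢j))

  -- Clique vertices of colour ≥ 2 have distinct colours: they lie at distance two.
  cv-colours-differ : ∀ {i j} → i ≢ j → 1 ≤ rank (cv i) → c (cv i) ≢ c (cv j)
  cv-colours-differ {i} {j} i≢j i-higher =
    separated (cv≢ i≢j) (enterˡ i j i≢j ++ʷ leaveʳ i j i≢j) (s≤s i-higher)

  -- Case A: if no clique vertex has colour 1, their W distinct colours leave out colour 1.
  no-colour-1 : (∀ j → rank (cv j) ≢ 0) → suc W ≤ K
  no-colour-1 none =
    distinct-nonzero⇒< (c ∘ cv) (λ i j i≢j → cv-colours-differ i≢j (n≢0⇒n>0 (none i))) none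

  one-has-colour-1 : ∀ {i j} → i ≢ j → rank (cv i) ≤ 1 → rank (cv j) ≤ 1 →
                     rank (cv i) ≡ 0 ⊎ rank (cv j) ≡ 0
  one-has-colour-1 i≢j i-low j-low with in-pair z≤n i-low | in-pair z≤n j-low
  ... | inj₁ i-colour-1 | _              = inj₁ i-colour-1
  ... | inj₂ _          | inj₁ j-colour-1 = inj₂ j-colour-1
  ... | inj₂ i-colour-2 | inj₂ j-colour-2 =
    ⊥-elim (cv-colours-differ i≢j (≤-reflexive (≡-sym i-colour-2))
              (FinP.toℕ-injective (trans i-colour-2 (≡-sym j-colour-2))))

  other : Fin W → Fin w₁ → Fin W
  other = punchIn

  x≢other : ∀ x i → x ≢ other x i
  x≢other x i = FinP.punchInᵢ≢i x i ∘ ≡-sym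

  others-differ : ∀ x {i i'} → i ≢ i' → other x i ≢ other x i'
  others-differ x {i} {i'} i≢i' = i≢i' ∘ FinP.punchIn-injective x i i'

  module Centre (x : Fin W) (x-colour-1 : rank (cv x) ≡ 0) where

    spoke : Fin w₁ → V F
    spoke i = sub x (other x i) (x≢other x i)

    spoke-higher : ∀ i → 1 ≤ rank (spoke i)
    spoke-higher i = beside-colour-1 {cv x} {spoke i} (mid-endˡ _ _ _) x-colour-1

    -- The spokes pairwise lie at distance two (through x), so have distinct colours.
    spokes-differ : Distinct (c ∘ spoke)
    spokes-differ i i' i≢i' =
      separated (edge≢ x (other x i) _ (mid-endʳ (e x) (e (other x i')) _)
                   (x≢other x i' ∘ ≡-sym) (others-differ x (i≢i' ∘ ≡-sym)))
                (leaveˡ x (other x i) _ ++ʷ enterˡ x (other x i') _)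
                (s≤s (spoke-higher i))

    hub-colours : Distinct (c (cv x) ◂ (c ∘ spoke))
    hub-colours = distinct-◂ spokes-differ λ i → colour-1≢higher x-colour-1 (spoke-higher i)

    one-more : ∀ v → 1 ≤ rank v → (∀ i → c v ≢ c (spoke i)) → suc W ≤ K
    one-more v v-higher fresh =
      distinct⇒≤ (c v ◂ (c (cv x) ◂ (c ∘ spoke))) (distinct-◂ hub-colours new)
      where
      new : ∀ i → c v ≢ (c (cv x) ◂ (c ∘ spoke)) i
      new zero    = colour-1≢higher x-colour-1 v-higher ∘ ≡-sym
      new (suc i) = fresh i

    -- Case B1: another clique vertex y of colour ≥ 3 is within distance 3 of every
    -- spoke (y – x – spoke).
    far-vertex : ∀ i → 2 ≤ rank (cv (other x i)) → suc W ≤ K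
    far-vertex i y-high = one-more (cv y) (≤-trans (s≤s z≤n) y-high) λ i' →
      separated (λ ())
        (enterʳ x y x≢y ++ʷ leaveˡ x y x≢y ++ʷ enterˡ x (other x i') _)
        (s≤s y-high)
      where
      y = other x i
      x≢y = x≢other x i

    -- Case B2: an edge y – z away from x whose vertex has colour ≥ 4 is within
    -- distance 4 of every spoke (yz – y – x – spoke).
    far-edge : ∀ y z y≢z → x ≢ y → x ≢ z → 3 ≤ rank (sub y z y≢z) → suc W ≤ K
    far-edge y z y≢z x≢y x≢z yz-high = one-more (sub y z y≢z) (≤-trans (s≤s z≤n) yz-high) λ i →
      separated (edge≢ y z y≢z (mid-endˡ (e x) (e (other x i)) _) x≢y x≢z)
        (leaveˡ y z y≢z ++ʷ enterˡ y x y≢x ++ʷ leaveʳ y x y≢x ++ʷ enterˡ x (other x i) _)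
        (s≤s yz-high)
      where
      y≢x : y ≢ x
      y≢x = x≢y ∘ ≡-sym

    -- Case B3: if y and z are the only other clique vertices and one has colour 1,
    -- the vertex of y – z has colour ≥ 2 and lies at distance 2 from both spokes.
    covering-edge : ∀ iy iz (iy≢iz : iy ≢ iz) →
                    rank (cv (other x iy)) ≡ 0 ⊎ rank (cv (other x iz)) ≡ 0 →
                    (∀ i → i ≡ iy ⊎ i ≡ iz) → suc W ≤ K
    covering-edge iy iz iy≢iz one-colour-1 cover = one-more v v-higher fresh
      where
      y = other x iy
      z = other x iz
      y≢z = others-differ x iy≢iz
      v = sub y z y≢z
      v-higher : 1 ≤ rank v
      v-higher = [ beside-colour-1 {cv y} {v} (mid-endˡ (e y) (e z) _) ,
                   beside-colour-1 {cv z} {v} (mid-endʳ (e y) (e z) _) ]′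
                   one-colour-1
      v≢spoke : ∀ i → v ≢ spoke i
      v≢spoke i = edge≢ y z y≢z (mid-endˡ (e x) (e (other x i)) _) (x≢other x iy) (x≢other x iz)
      fresh : ∀ i → c v ≢ c (spoke i)
      fresh i with cover i
      ... | inj₁ refl = separated (v≢spoke i)
                          (leaveˡ y z y≢z ++ʷ enterʳ x y _) (s≤s v-higher)
      ... | inj₂ refl = separated (v≢spoke i)
                          (leaveʳ y z y≢z ++ʷ enterʳ x z _) (s≤s v-higher)

  -- Three clique vertices x, y, z of colour 1.  The vertices A, B, C of the edges
  -- y z, x z, x y pairwise share an end, so carry distinct colours ≥ 2; if one has
  -- colour ≥ 4 we conclude by far-edge (centred at the opposite corner), and
  -- otherwise three distinct colours would lie in {2, 3}.
  triangle : ∀ x y z (x≢y : x ≢ y) (x≢z : x ≢ z) (y≢z : y ≢ z) →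
             rank (cv x) ≡ 0 → rank (cv y) ≡ 0 → rank (cv z) ≡ 0 → suc W ≤ K
  triangle x y z x≢y x≢z y≢z x-colour-1 y-colour-1 z-colour-1 =
    decide (3 ≤? rank A) (3 ≤? rank B) (3 ≤? rank C)
    where
    A = sub y z y≢z
    B = sub x z x≢z
    C = sub x y x≢y
    A-higher : 1 ≤ rank A
    A-higher = beside-colour-1 {cv y} {A} (mid-endˡ (e y) (e z) _) y-colour-1
    B-higher : 1 ≤ rank B
    B-higher = beside-colour-1 {cv x} {B} (mid-endˡ (e x) (e z) _) x-colour-1
    AB : c A ≢ c B
    AB = separated (edge≢ y z y≢z (mid-endˡ (e x) (e z) _) x≢y x≢z)
                   (leaveʳ y z y≢z ++ʷ enterʳ x z x≢z) (s≤s A-higher)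
    BC : c B ≢ c C
    BC = separated (edge≢ x z x≢z (mid-endʳ (e x) (e y) _) (x≢y ∘ ≡-sym) y≢z)
                   (leaveˡ x z x≢z ++ʷ enterˡ x y x≢y) (s≤s B-higher)
    AC : c A ≢ c C
    AC = separated (edge≢ y z y≢z (mid-endˡ (e x) (e y) _) x≢y x≢z)
                   (leaveˡ y z y≢z ++ʷ enterʳ x y x≢y) (s≤s A-higher)
    low : ∀ {v} → 1 ≤ rank v → ¬ 3 ≤ rank v → InPair 1 (rank v)
    low v-higher v-not-high = in-pair v-higher (≤-pred (≰⇒> v-not-high))
    decide : Dec (3 ≤ rank A) → Dec (3 ≤ rank B) → Dec (3 ≤ rank C) → suc W ≤ K
    decide (yes A-high) _ _ = Centre.far-edge x x-colour-1 y z y≢z x≢y x≢z A-high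
    decide _ (yes B-high) _ = Centre.far-edge y y-colour-1 x z x≢z (x≢y ∘ ≡-sym) y≢z B-high
    decide _ _ (yes C-high) = Centre.far-edge z z-colour-1 x y x≢y (x≢z ∘ ≡-sym) (y≢z ∘ ≡-sym) C-high
    decide (no A-low) (no B-low) (no C-low) =
      ⊥-elim (AC (FinP.toℕ-injective
        (two-values (low A-higher A-low) (low B-higher B-low)
                    (low (beside-colour-1 {cv x} {C} (mid-endˡ (e x) (e y) _) x-colour-1) C-low)
                    (AB ∘ FinP.toℕ-injective) (BC ∘ FinP.toℕ-injective))))

  -- Cases A and B1 reduce everything to: some clique vertex x has colour 1 and all
  -- other clique vertices have colour ≤ 2.
  reduce-to-low-others : (∀ x → rank (cv x) ≡ 0 → (∀ i → rank (cv (other x i)) ≤ 1) → suc W ≤ K) →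
                         suc W ≤ K
  reduce-to-low-others remaining with FinP.any? (λ x → rank (cv x) ≟ 0)
  ... | no none = no-colour-1 (λ x x-colour-1 → none (x , x-colour-1))
  ... | yes (x , x-colour-1) with FinP.any? (λ i → 2 ≤? rank (cv (other x i)))
  ...   | yes (i , y-high) = Centre.far-vertex x x-colour-1 i y-high
  ...   | no none-high     =
    remaining x x-colour-1 λ i → ≤-pred (≰⇒> λ y-high → none-high (i , y-high))

  -- If x has colour 1 and three further clique vertices have colour ≤ 2, then two of
  -- those have colour 1 (one-has-colour-1, twice), and they form a triangle with x.
  three-others : ∀ x → rank (cv x) ≡ 0 → ∀ i j k → i ≢ j → i ≢ k → j ≢ k →
                 (∀ i → rank (cv (other x i)) ≤ 1) → suc W ≤ K
  three-others x x-colour-1 i j k i≢j i≢k j≢k low =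
    [ (λ i-colour-1 → [ triangle-with i≢j i-colour-1 , triangle-with i≢k i-colour-1 ]′ (pair j≢k))
    , (λ j-colour-1 → [ (λ i-colour-1 → triangle-with i≢j i-colour-1 j-colour-1)
                      , triangle-with j≢k j-colour-1 ]′ (pair i≢k))
    ]′ (pair i≢j)
    where
    pair : ∀ {i' j'} → i' ≢ j' → rank (cv (other x i')) ≡ 0 ⊎ rank (cv (other x j')) ≡ 0
    pair i'≢j' = one-has-colour-1 (others-differ x i'≢j') (low _) (low _)
    triangle-with : ∀ {i' j'} → i' ≢ j' → rank (cv (other x i')) ≡ 0 → rank (cv (other x j')) ≡ 0 → suc W ≤ K
    triangle-with {i'} {j'} i'≢j' =
      triangle x (other x i') (other x j') (x≢other x i') (x≢other x j') (others-differ x i'≢j') x-colour-1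

-- A clique of size W ≥ 3 forces W + 1 colours in every packing colouring of FSSD_m(G):
-- for W = 3 the remaining case is covering-edge, for W ≥ 4 it is three-others.
clique-bound : ∀ {n} (G : SimpleGraph n) {m} → Fin m →
               ∀ {K} (c : V (FSSD m G) → Fin K) → IsPackingColoring (FSSD m G) K c →
               ∀ W (e : Fin W → Fin n) → Distinct e → (∀ i j → i ≢ j → Adj (toGraph G) (e i) (e j)) →
               3 ≤ W → suc W ≤ K
clique-bound G i₀ c c-ok (suc (suc (suc zero))) e e-distinct e-clique (s≤s (s≤s (s≤s _))) =
  reduce-to-low-others λ x x-colour-1 low →
    Centre.covering-edge x x-colour-1 zero (suc zero) (λ ())
      (one-has-colour-1 (others-differ x (λ ())) (low zero) (low (suc zero))) two-others
  where
  open Clique G i₀ c c-ok 2 e e-distinct e-clique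
  two-others : ∀ (i : Fin 2) → i ≡ zero ⊎ i ≡ suc zero
  two-others zero       = inj₁ refl
  two-others (suc zero) = inj₂ refl
clique-bound G i₀ c c-ok (suc (suc (suc (suc w)))) e e-distinct e-clique (s≤s (s≤s (s≤s _))) =
  reduce-to-low-others λ x x-colour-1 →
    three-others x x-colour-1 zero (suc zero) (suc (suc zero)) (λ ()) (λ ()) (λ ())
  where open Clique G i₀ c c-ok (suc (suc (suc w))) e e-distinct e-clique

proposition3 : ∀ {n} (m : ℕ) → 1 ≤ m → (G : SimpleGraph n) → 3 ≤ n
    → Connected (toGraph G)
    → ∀ w k k' → IsCliqueNumber G w
    → IsPackingChromaticNumber (toGraph G) k
    → IsPackingChromaticNumber (FSSD m G) k'
    → (w + 1 ≤ k') × (k' ≤ k + 1)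
proposition3 (suc _) (s≤s z≤n) G (s≤s (s≤s (s≤s _))) connected w k k'
  ((S , S-clique , ∣S∣≡w) , _) (G-colouring , _) (F-colouring@(c , c-ok) , k'-minimal) = lower , upper
  where
  open Subdivision G _
  open Representatives zero
  upper : k' ≤ k + 1
  upper = k'-minimal (k + 1) (subst (HasPackingColoring F) (+-comm 1 k) (lift-colouring G-colouring))
  at-least-three : 3 ≤ k'
  at-least-three = two-path⇒three-colours
    (connected⇒two-path FinP._≟_ connected zero (suc zero) (suc (suc zero)) (λ ()) (λ ()) (λ ()))
    F-colouring
  lower : w + 1 ≤ k'
  lower with 3 ≤? w | enumerate S
  ... | no  w≤2 | _ = ≤-trans (+-monoˡ-≤ 1 (≤-pred (≰⇒> w≤2))) at-least-three
  ... | yes 3≤w | e , e-distinct , e∈S =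
    subst (_≤ k') (trans (cong suc ∣S∣≡w) (+-comm 1 w))
      (clique-bound G zero c c-ok ∣ S ∣ e e-distinct
        (λ i j i≢j → S-clique (e i) (e j) (e∈S i) (e∈S j) (e-distinct i j i≢j))
        (subst (3 ≤_) (≡-sym ∣S∣≡w) 3≤w))
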